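{- Consider the instance $X$ described in the context. Let $0 \le t \le k-1$ and let $C_t$ be the set of $1+t$ centers chosen in the first $1+t$ iterations of the k-means++ seeding algorithm on $X$, where the first chosen center is located at $(0,0)$. Let $s$ be the number of groups among $G_1, \dots, G_{k-1}$ that contain a point of $C_t$ (covered groups), and let $X_u$ be the union of the groups among $G_1, \dots, G_{k-1}$ that contain no point of $C_t$. Then \[ \Phi_{C_t}(X_u) \le (40 k)(k - s - 1)\, m r^2 \Delta^2 . \]
   Context: Fix an integer $k \ge 2$, a positive integer $m$ such that all multiplicities below are integers (e.g. $4^{2k}$ divides $m$), a real $r > 0$ and a real $\Delta \ge 1$. For $1 \le i \le k-1$ let $r_i = 2^{i-1} r$ and $m_i = m/4^{i-1}$; let $x_0 = 0$ and $x_i = \Delta (r_1 + \dots + r_i)$. The instance $X$ is the multiset of points in $\mathbb{R}^2$ consisting of groups $G_0, \dots, G_{k-1}$: $G_0$ consists of $12 k 2^k m$ copies of $(0,0)$; for $1 \le i \le k-1$, $G_i$ consists of $4 k m_i$ copies of $(x_i, 0)$ and, for each $0 \le j \le k-1$, $m_i/4^j$ copies of $(x_i, 2^j r_i)$ and $m_i/4^j$ copies of $(x_i, -2^j r_i)$. The k-means++ seeding algorithm chooses its first center uniformly at random among the points of $X$ (counted with multiplicity), and each subsequent center as a point $p \in X$ with probability proportional to $\min_{c \in C} D(p,c)$ ($D$ = squared Euclidean distance, $C$ = centers chosen so far). For a set of centers $C$ and $Y \subseteq X$, $\Phi_C(Y) = \sum_{y \in Y} \min_{c \in C} D(y,c)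$.
   Formalization: The parameters r and Δ are rational rather than real, so the points of the instance X and the chosen centers have rational coordinates. -}

module Defs where

open import Data.Nat as ℕ using (ℕ; zero; suc; _∸_; _^_)
open import Data.Nat.Properties using (m^n≢0)
open import Data.Integer using (+_)
open import Data.Rational using (ℚ; 0ℚ; _+_; _*_; _-_; -_; _⊓_; _≟_)
import Data.Rational as Q
open import Data.Bool using (Bool; true; false; _∧_; not)
open import Data.List using (List; []; _∷_; map; upTo; concatMap; filter; length; foldr)
open import Data.Bool.ListAction using (any)
open import Data.Product using (_×_; _,_; proj₁; proj₂)
open import Relation.Nullary.Decidable using (⌊_⌋)
open import Relation.Binary.PropositionalEquality using (_≡_)

sumℚ : List ℚ → ℚ
sumℚ = foldr _+_ 0ℚ

Pt : Set
Pt = ℚ × ℚ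

ℕ→ℚ : ℕ → ℚ
ℕ→ℚ n = (+ n) Q./ 1

D : Pt → Pt → ℚ
D (a , b) (c , d) = ((a - c) * (a - c)) + ((b - d) * (b - d))

-- An entry of the multiset X: (group index, location, multiplicity)
record Entry : Set where
  constructor entry
  field
    grp  : ℕ
    pt   : Pt
    mult : ℕ
open Entry public

-- m / 4^e (natural division; exact under the divisibility hypothesis)
div4^ : ℕ → ℕ → ℕ
div4^ m e = ℕ._/_ m (4 ^ e) {{m^n≢0 4 e}}

rᵢ : ℚ → ℕ → ℚ
rᵢ r l = ℕ→ℚ (2 ^ (l ∸ 1)) * r

mᵢ : ℕ → ℕ → ℕ
mᵢ m l = div4^ m (l ∸ 1)

xᵢ : ℚ → ℚ → ℕ → ℚ
xᵢ r Δ i = Δ * sumℚ (map (λ l → rᵢ r (suc l)) (upTo i))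

groupG : ℕ → ℕ → ℚ → ℚ → ℕ → List Entry
groupG k m r Δ i =
  entry i (xᵢ r Δ i , 0ℚ) (4 ℕ.* k ℕ.* mᵢ m i)
  ∷ concatMap (λ j →
       entry i (xᵢ r Δ i , ℕ→ℚ (2 ^ j) * rᵢ r i) (div4^ (mᵢ m i) j)
       ∷ entry i (xᵢ r Δ i , - (ℕ→ℚ (2 ^ j) * rᵢ r i)) (div4^ (mᵢ m i) j)
       ∷ []) (upTo k)

groupIdx : ℕ → List ℕ
groupIdx k = map suc (upTo (k ∸ 1))

instanceX : ℕ → ℕ → ℚ → ℚ → List Entry
instanceX k m r Δ =
  entry 0 (0ℚ , 0ℚ) (12 ℕ.* k ℕ.* 2 ^ k ℕ.* m)
  ∷ concatMap (groupG k m r Δ) (groupIdx k)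

eqPt : Pt → Pt → Bool
eqPt (a , b) (c , d) = ⌊ a ≟ c ⌋ ∧ ⌊ b ≟ d ⌋

InX : List Entry → Pt → Set
InX X p = any (λ e → eqPt (pt e) p ∧ not ⌊ mult e ℕ.≟ 0 ⌋) X ≡ true

covered : List Entry → List Pt → ℕ → Bool
covered X C i =
  any (λ e → ⌊ grp e ℕ.≟ i ⌋ ∧ not ⌊ mult e ℕ.≟ 0 ⌋ ∧ any (eqPt (pt e)) C) X

numCovered : ℕ → List Entry → List Pt → ℕ
numCovered k X C = length (filter (λ i → covered X C i ≟b true) (groupIdx k))
  where
  open import Data.Bool.Properties renaming (_≟_ to _≟b_)

minD : Pt → List Pt → Pt → ℚ
minD c cs p = foldr (λ c' acc → D p c' ⊓ acc) (D p c) cs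

Φ : Pt → List Pt → List Entry → ℚ
Φ c cs Y = sumℚ (map (λ e → ℕ→ℚ (mult e) * minD c cs (pt e)) Y)

uncoveredPart : ℕ → List Entry → List Pt → List Entry
uncoveredPart k X C =
  filter (λ e → ((1 ℕ.≤? grp e) Relation.Nullary.×-dec (grp e ℕ.<? k))
                Relation.Nullary.×-dec (covered X C (grp e) ≟b false)) X
  where
  open import Data.Bool.Properties renaming (_≟_ to _≟b_)
  import Relation.Nullary

{-# OPTIONS --safe #-}
-- Adding centres can only lower costs, so every point of an uncovered group G_i costs at
-- most its squared distance to the first centre (0,0). Since x_i ≤ 2^i r Δ, the 4 k m_i
-- copies of (x_i, 0) cost at most 16 k m r²Δ² and each of the 2k arm points at most
-- 5 m r²Δ², so each uncovered group costs at most 40 k m r²Δ²; there are k - 1 - s of them.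
module Submission where

open import Defs
open import Algebra.Bundles using (Ring)
open import Data.Bool using (true; false)
import Data.Bool.Properties as Bool
open import Data.Empty using (⊥; ⊥-elim)
open import Data.Integer as ℤ using ()
open import Data.Integer.Solver using (module +-*-Solver)
open import Data.List using (List; []; _∷_; _++_; [_]; map; concatMap; filter; length; upTo)
import Data.List.Properties as List
open import Data.List.Relation.Unary.All as All using (All; []; _∷_)
open import Data.List.Relation.Unary.All.Properties using (applyUpTo⁺₂; all-filter; concat⁺; map⁺)
open import Data.List.Relation.Unary.AllPairs using (AllPairs)
open import Data.Nat as ℕ using (ℕ; zero; suc; _^_; _∸_; z≤n; s≤s)
import Data.Nat.Coprimality as Coprime
open import Data.Nat.Divisibility using (_∣_)
open import Data.Nat.DivMod using (m/n*n≤m; m/n≤m)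
open import Data.Nat.ListAction using (sum)
open import Data.Nat.ListAction.Properties using (sum-++)
import Data.Nat.Properties as ℕ
import Data.Nat.Solver as ℕ-Solver
open import Data.Product using (_×_; _,_)
open import Data.Rational using (ℚ; 0ℚ; 1ℚ; _+_; _*_; -_; _≤_; _<_; NonNegative; nonNegative; toℚᵘ)
open import Data.Rational.Properties
import Algebra.Properties.Semiring.Mult (Ring.semiring +-*-ring) as Mult
import Data.Rational.Solver as ℚ-Solver
import Data.Rational.Unnormalised as ℚᵘ
import Data.Rational.Unnormalised.Properties as ℚᵘ
open import Function using (_∘_; id; case_of_)
open import Relation.Nullary using (yes; no; _×-dec_)
open import Relation.Unary using (Pred; Decidable)
open import Relation.Binary.PropositionalEquality
  using (_≡_; _≢_; refl; sym; trans; cong; cong₂; subst; module ≡-Reasoning)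

ℕ→ℚ-toℚᵘ : ∀ n → toℚᵘ (ℕ→ℚ n) ≡ ℚᵘ.mkℚᵘ (ℤ.+ n) 0
ℕ→ℚ-toℚᵘ n = cong toℚᵘ (normalize-coprime (Coprime.sym (Coprime.1-coprimeTo n)))

ℕ→ℚ-suc : ∀ n → ℕ→ℚ (suc n) ≡ 1ℚ + ℕ→ℚ n
ℕ→ℚ-suc n = toℚᵘ-injective (begin
  toℚᵘ (ℕ→ℚ (suc n))                  ≡⟨ ℕ→ℚ-toℚᵘ (suc n) ⟩
  ℚᵘ.mkℚᵘ (ℤ.+ suc n) 0               ≈⟨ ℚᵘ.*≡* (solve 1 (λ x → (con ℤ.1ℤ :+ x) :* con ℤ.1ℤ
                                              := (con ℤ.1ℤ :* con ℤ.1ℤ :+ x :* con ℤ.1ℤ) :* con ℤ.1ℤ) refl (ℤ.+ n)) ⟩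
  toℚᵘ 1ℚ ℚᵘ.+ ℚᵘ.mkℚᵘ (ℤ.+ n) 0     ≡⟨ cong (toℚᵘ 1ℚ ℚᵘ.+_) (ℕ→ℚ-toℚᵘ n) ⟨
  toℚᵘ 1ℚ ℚᵘ.+ toℚᵘ (ℕ→ℚ n)           ≈⟨ toℚᵘ-homo-+ 1ℚ (ℕ→ℚ n) ⟨
  toℚᵘ (1ℚ + ℕ→ℚ n)                   ∎)
  where open ℚᵘ.≃-Reasoning
        open +-*-Solver

ℕ→ℚ≗×1ℚ : ∀ n → ℕ→ℚ n ≡ n Mult.× 1ℚ
ℕ→ℚ≗×1ℚ zero    = refl
ℕ→ℚ≗×1ℚ (suc n) = trans (ℕ→ℚ-suc n) (cong (1ℚ +_) (ℕ→ℚ≗×1ℚ n))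

ℕ→ℚ-homo-+ : ∀ a b → ℕ→ℚ (a ℕ.+ b) ≡ ℕ→ℚ a + ℕ→ℚ b
ℕ→ℚ-homo-+ a b rewrite ℕ→ℚ≗×1ℚ (a ℕ.+ b) | ℕ→ℚ≗×1ℚ a | ℕ→ℚ≗×1ℚ b = Mult.×-homo-+ 1ℚ a b

ℕ→ℚ-homo-* : ∀ a b → ℕ→ℚ (a ℕ.* b) ≡ ℕ→ℚ a * ℕ→ℚ b
ℕ→ℚ-homo-* a b rewrite ℕ→ℚ≗×1ℚ (a ℕ.* b) | ℕ→ℚ≗×1ℚ a | ℕ→ℚ≗×1ℚ b = Mult.×1-homo-* a b

ℕ→ℚ-nonNeg : ∀ n → NonNegative (ℕ→ℚ n)
ℕ→ℚ-nonNeg n = normalize-nonNeg n 1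

ℕ→ℚ-mono-≤ : ∀ {a b} → a ℕ.≤ b → ℕ→ℚ a ≤ ℕ→ℚ b
ℕ→ℚ-mono-≤ {a} {b} a≤b = begin
  ℕ→ℚ a                   ≡⟨ +-identityʳ (ℕ→ℚ a) ⟨
  ℕ→ℚ a + 0ℚ              ≤⟨ +-monoʳ-≤ (ℕ→ℚ a) (nonNegative⁻¹ _ {{ℕ→ℚ-nonNeg (b ∸ a)}}) ⟩
  ℕ→ℚ a + ℕ→ℚ (b ∸ a)     ≡⟨ ℕ→ℚ-homo-+ a (b ∸ a) ⟨
  ℕ→ℚ (a ℕ.+ (b ∸ a))     ≡⟨ cong ℕ→ℚ (ℕ.m+[n∸m]≡n a≤b) ⟩
  ℕ→ℚ b                   ∎
  where open ≤-Reasoning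

module _ (K : ℚ) where

  ℕ→ℚ-*-scaled : ∀ p q → ℕ→ℚ p * (ℕ→ℚ q * K) ≡ ℕ→ℚ (p ℕ.* q) * K
  ℕ→ℚ-*-scaled p q = trans (sym (*-assoc (ℕ→ℚ p) (ℕ→ℚ q) K)) (cong (_* K) (sym (ℕ→ℚ-homo-* p q)))

  +-mono-scaled : ∀ p q {a b} → a ≤ ℕ→ℚ p * K → b ≤ ℕ→ℚ q * K → a + b ≤ ℕ→ℚ (p ℕ.+ q) * K
  +-mono-scaled p q a≤ b≤ = ≤-trans (+-mono-≤ a≤ b≤)
    (≤-reflexive (trans (sym (*-distribʳ-+ K (ℕ→ℚ p) (ℕ→ℚ q))) (cong (_* K) (sym (ℕ→ℚ-homo-+ p q)))))

  scaled-mono-≤ : .{{NonNegative K}} → ∀ {a p q} → a ≤ ℕ→ℚ p * K → p ℕ.≤ q → a ≤ ℕ→ℚ q * K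
  scaled-mono-≤ a≤ p≤q = ≤-trans a≤ (*-monoʳ-≤-nonNeg K (ℕ→ℚ-mono-≤ p≤q))

module _ {a} {A : Set a} (f : A → ℚ) where

  sumℚ-map-++ : ∀ xs ys → sumℚ (map f (xs ++ ys)) ≡ sumℚ (map f xs) + sumℚ (map f ys)
  sumℚ-map-++ []       ys = sym (+-identityˡ _)
  sumℚ-map-++ (x ∷ xs) ys = trans (cong (f x +_) (sumℚ-map-++ xs ys)) (sym (+-assoc (f x) _ _))

  sumℚ-map-mono-≤ : ∀ {g : A → ℚ} → (∀ x → f x ≤ g x) → ∀ xs → sumℚ (map f xs) ≤ sumℚ (map g xs)
  sumℚ-map-mono-≤ f≤g []       = ≤-refl
  sumℚ-map-mono-≤ f≤g (x ∷ xs) = +-mono-≤ (f≤g x) (sumℚ-map-mono-≤ f≤g xs)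

  sumℚ-map-concatMap-≤ : ∀ {b} {B : Set b} {g : B → List A} {c bs} →
    All (λ y → sumℚ (map f (g y)) ≤ c) bs → sumℚ (map f (concatMap g bs)) ≤ ℕ→ℚ (length bs) * c
  sumℚ-map-concatMap-≤ {c = c} [] = ≤-reflexive (sym (*-zeroˡ c))
  sumℚ-map-concatMap-≤ {g = g} {c} {y ∷ ys} (gy≤c ∷ gys≤c) = begin
    sumℚ (map f (g y ++ concatMap g ys))             ≡⟨ sumℚ-map-++ (g y) (concatMap g ys) ⟩
    sumℚ (map f (g y)) + sumℚ (map f (concatMap g ys)) ≤⟨ +-mono-≤ gy≤c (sumℚ-map-concatMap-≤ gys≤c) ⟩
    c + ℕ→ℚ (length ys) * c                          ≡⟨ cong (_+ ℕ→ℚ (length ys) * c) (*-identityˡ c) ⟨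
    1ℚ * c + ℕ→ℚ (length ys) * c                     ≡⟨ *-distribʳ-+ c 1ℚ (ℕ→ℚ (length ys)) ⟨
    (1ℚ + ℕ→ℚ (length ys)) * c                       ≡⟨ cong (_* c) (ℕ→ℚ-suc (length ys)) ⟨
    ℕ→ℚ (length (y ∷ ys)) * c                        ∎
    where open ≤-Reasoning

sumℚ-map-scaled : ∀ {a} {A : Set a} (f : A → ℕ) q xs →
  sumℚ (map (λ x → ℕ→ℚ (f x) * q) xs) ≡ ℕ→ℚ (sum (map f xs)) * q
sumℚ-map-scaled f q []       = sym (*-zeroˡ q)
sumℚ-map-scaled f q (x ∷ xs) = begin
  ℕ→ℚ (f x) * q + sumℚ (map (λ x → ℕ→ℚ (f x) * q) xs) ≡⟨ cong (ℕ→ℚ (f x) * q +_) (sumℚ-map-scaled f q xs) ⟩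
  ℕ→ℚ (f x) * q + ℕ→ℚ (sum (map f xs)) * q           ≡⟨ *-distribʳ-+ q (ℕ→ℚ (f x)) _ ⟨
  (ℕ→ℚ (f x) + ℕ→ℚ (sum (map f xs))) * q             ≡⟨ cong (_* q) (ℕ→ℚ-homo-+ (f x) _) ⟨
  ℕ→ℚ (f x ℕ.+ sum (map f xs)) * q                   ∎
  where open ≡-Reasoning

module _ {a b p} {A : Set a} {B : Set b} {P : Pred B p} (P? : Decidable P) where

  filter-concatMap : (f : A → B) (g : B → List A) → (∀ y → All (λ x → f x ≡ y) (g y)) →
    ∀ ys → filter (P? ∘ f) (concatMap g ys) ≡ concatMap g (filter P? ys)
  filter-concatMap f g fibre [] = refl
  filter-concatMap f g fibre (y ∷ ys) with P? y
  ... | yes Py = begin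
    filter (P? ∘ f) (g y ++ concatMap g ys)                 ≡⟨ List.filter-++ (P? ∘ f) (g y) _ ⟩
    filter (P? ∘ f) (g y) ++ filter (P? ∘ f) (concatMap g ys) ≡⟨ cong₂ _++_ keep (filter-concatMap f g fibre ys) ⟩
    g y ++ concatMap g (filter P? ys)                         ∎
    where open ≡-Reasoning
          keep = List.filter-all (P? ∘ f) (All.map (λ fx≡y → subst P (sym fx≡y) Py) (fibre y))
  ... | no ¬Py = begin
    filter (P? ∘ f) (g y ++ concatMap g ys)                 ≡⟨ List.filter-++ (P? ∘ f) (g y) _ ⟩
    filter (P? ∘ f) (g y) ++ filter (P? ∘ f) (concatMap g ys) ≡⟨ cong₂ _++_ drop (filter-concatMap f g fibre ys) ⟩
    concatMap g (filter P? ys)                                ∎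
    where open ≡-Reasoning
          drop = List.filter-none (P? ∘ f) (All.map (λ fx≡y → ¬Py ∘ subst P fx≡y) (fibre y))

length-filter-disjoint : ∀ {a p q} {A : Set a} {P : Pred A p} {Q : Pred A q} (P? : Decidable P) (Q? : Decidable Q) →
  (∀ {x} → P x → Q x → ⊥) → ∀ xs → length (filter P? xs) ℕ.+ length (filter Q? xs) ℕ.≤ length xs
length-filter-disjoint P? Q? disjoint [] = z≤n
length-filter-disjoint P? Q? disjoint (x ∷ xs) with P? x | Q? x | length-filter-disjoint P? Q? disjoint xs
... | yes Px | yes Qx | _  = ⊥-elim (disjoint Px Qx)
... | yes _  | no _   | ih = s≤s ih
... | no _   | yes _  | ih = subst (ℕ._≤ suc (length xs)) (sym (ℕ.+-suc _ _)) (s≤s ih)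
... | no _   | no _   | ih = ℕ.m≤n⇒m≤1+n ih

2^*2^≡4^ : ∀ n → 2 ^ n ℕ.* 2 ^ n ≡ 4 ^ n
2^*2^≡4^ zero    = refl
2^*2^≡4^ (suc n) = begin
  (2 ℕ.* 2 ^ n) ℕ.* (2 ℕ.* 2 ^ n) ≡⟨ solve 1 (λ x → (con 2 :* x) :* (con 2 :* x) := con 4 :* (x :* x)) refl (2 ^ n) ⟩
  4 ℕ.* (2 ^ n ℕ.* 2 ^ n)         ≡⟨ cong (4 ℕ.*_) (2^*2^≡4^ n) ⟩
  4 ℕ.* 4 ^ n                     ∎
  where open ≡-Reasoning
        open ℕ-Solver.+-*-Solver

sum-2^-upTo< : ∀ n → sum (map (2 ^_) (upTo n)) ℕ.< 2 ^ n
sum-2^-upTo< zero    = s≤s z≤n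
sum-2^-upTo< (suc n) = begin-strict
  sum (map (2 ^_) (upTo (suc n)))           ≡⟨ cong (sum ∘ map (2 ^_)) (List.upTo-∷ʳ n) ⟨
  sum (map (2 ^_) (upTo n ++ [ n ]))        ≡⟨ cong sum (List.map-++ (2 ^_) (upTo n) [ n ]) ⟩
  sum (map (2 ^_) (upTo n) ++ [ 2 ^ n ])    ≡⟨ sum-++ (map (2 ^_) (upTo n)) [ 2 ^ n ] ⟩
  sum (map (2 ^_) (upTo n)) ℕ.+ (2 ^ n ℕ.+ 0) <⟨ ℕ.+-monoˡ-< (2 ^ n ℕ.+ 0) (sum-2^-upTo< n) ⟩
  2 ^ n ℕ.+ (2 ^ n ℕ.+ 0)                   ≡⟨⟩
  2 ^ suc n                                 ∎
  where open ℕ.≤-Reasoning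

sum-2^-upTo-sq≤ : ∀ n → let s = sum (map (2 ^_) (upTo n)) in s ℕ.* s ℕ.≤ 4 ^ n
sum-2^-upTo-sq≤ n = ℕ.≤-trans (ℕ.*-mono-≤ s≤ s≤) (ℕ.≤-reflexive (2^*2^≡4^ n))
  where s≤ = ℕ.<⇒≤ (sum-2^-upTo< n)

div4^-*4^≤ : ∀ m e → div4^ m e ℕ.* 4 ^ e ℕ.≤ m
div4^-*4^≤ m e = m/n*n≤m m (4 ^ e) {{ℕ.m^n≢0 4 e}}

centre-weight≤ : ∀ k m l → 4 ℕ.* k ℕ.* div4^ m l ℕ.* (4 ^ suc l ℕ.+ 0) ℕ.≤ 16 ℕ.* k ℕ.* m
centre-weight≤ k m l = begin
  4 ℕ.* k ℕ.* div4^ m l ℕ.* (4 ℕ.* 4 ^ l ℕ.+ 0)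
    ≡⟨ solve 3 (λ k a q → con 4 :* k :* a :* (con 4 :* q :+ con 0) := con 16 :* k :* (a :* q)) refl k (div4^ m l) (4 ^ l) ⟩
  16 ℕ.* k ℕ.* (div4^ m l ℕ.* 4 ^ l) ≤⟨ ℕ.*-monoʳ-≤ (16 ℕ.* k) (div4^-*4^≤ m l) ⟩
  16 ℕ.* k ℕ.* m                     ∎
  where open ℕ.≤-Reasoning
        open ℕ-Solver.+-*-Solver

arm-weight≤ : ∀ m l j → div4^ (div4^ m l) j ℕ.* (4 ^ suc l ℕ.+ 4 ^ j ℕ.* 4 ^ l) ℕ.≤ 5 ℕ.* m
arm-weight≤ m l j = begin
  a ℕ.* (4 ℕ.* 4 ^ l ℕ.+ 4 ^ j ℕ.* 4 ^ l)
    ≡⟨ solve 4 (λ a q p b → a :* (con 4 :* q :+ p :* q) := con 4 :* (a :* q) :+ (a :* p) :* q) refl a (4 ^ l) (4 ^ j) b ⟩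
  4 ℕ.* (a ℕ.* 4 ^ l) ℕ.+ (a ℕ.* 4 ^ j) ℕ.* 4 ^ l
    ≤⟨ ℕ.+-mono-≤ (ℕ.*-monoʳ-≤ 4 (ℕ.*-monoˡ-≤ (4 ^ l) (m/n≤m b (4 ^ j) {{ℕ.m^n≢0 4 j}})))
                  (ℕ.*-monoˡ-≤ (4 ^ l) (div4^-*4^≤ b j)) ⟩
  4 ℕ.* (b ℕ.* 4 ^ l) ℕ.+ b ℕ.* 4 ^ l
    ≡⟨ solve 2 (λ b q → con 4 :* (b :* q) :+ b :* q := con 5 :* (b :* q)) refl b (4 ^ l) ⟩
  5 ℕ.* (b ℕ.* 4 ^ l) ≤⟨ ℕ.*-monoʳ-≤ 5 (div4^-*4^≤ m l) ⟩
  5 ℕ.* m             ∎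
  where open ℕ.≤-Reasoning
        open ℕ-Solver.+-*-Solver
        b = div4^ m l
        a = div4^ b j

group-weight≤ : ∀ k m → 16 ℕ.* k ℕ.* m ℕ.+ k ℕ.* (5 ℕ.* m ℕ.+ (5 ℕ.* m ℕ.+ 0)) ℕ.≤ 40 ℕ.* k ℕ.* m
group-weight≤ k m = begin
  16 ℕ.* k ℕ.* m ℕ.+ k ℕ.* (5 ℕ.* m ℕ.+ (5 ℕ.* m ℕ.+ 0))
    ≡⟨ solve 2 (λ k m → con 16 :* k :* m :+ k :* (con 5 :* m :+ (con 5 :* m :+ con 0)) := con 26 :* (k :* m)) refl k m ⟩
  26 ℕ.* (k ℕ.* m) ≤⟨ ℕ.*-monoˡ-≤ (k ℕ.* m) (ℕ.m≤m+n 26 14) ⟩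
  40 ℕ.* (k ℕ.* m) ≡⟨ ℕ.*-assoc 40 k m ⟨
  40 ℕ.* k ℕ.* m   ∎
  where open ℕ.≤-Reasoning
        open ℕ-Solver.+-*-Solver

ℕ→ℚ-2^-sq : ∀ n → ℕ→ℚ (2 ^ n) * ℕ→ℚ (2 ^ n) ≡ ℕ→ℚ (4 ^ n)
ℕ→ℚ-2^-sq n = trans (sym (ℕ→ℚ-homo-* (2 ^ n) (2 ^ n))) (cong ℕ→ℚ (2^*2^≡4^ n))

origin : Pt
origin = 0ℚ , 0ℚ

D-origin : ∀ a b → D (a , b) origin ≡ a * a + b * b
D-origin a b = cong₂ (λ u v → u * u + v * v) (+-identityʳ a) (+-identityʳ b)

minD≤D : ∀ c cs p → minD c cs p ≤ D p c
minD≤D c []        p = ≤-refl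
minD≤D c (c′ ∷ cs) p = ≤-trans (p⊓q≤q (D p c′) _) (minD≤D c cs p)

Φ≤Φ-first : ∀ c cs Y → Φ c cs Y ≤ Φ c [] Y
Φ≤Φ-first c cs = sumℚ-map-mono-≤ _ λ e →
  *-monoˡ-≤-nonNeg (ℕ→ℚ (mult e)) {{ℕ→ℚ-nonNeg (mult e)}} (minD≤D c cs (pt e))

cost₀ : Entry → ℚ
cost₀ e = ℕ→ℚ (mult e) * D (pt e) origin

module GroupCost (k m : ℕ) (r Δ : ℚ) {{r≥0 : NonNegative r}} (1≤Δ : 1ℚ ≤ Δ) where

  K : ℚ
  K = r * r * (Δ * Δ)

  instance
    Δ≥0 : NonNegative Δ
    Δ≥0 = nonNegative (≤-trans (nonNegative⁻¹ 1ℚ) 1≤Δ)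

    K≥0 : NonNegative K
    K≥0 = nonNeg*nonNeg⇒nonNeg (r * r) {{nonNeg*nonNeg⇒nonNeg r r}} (Δ * Δ) {{nonNeg*nonNeg⇒nonNeg Δ Δ}}

  r*r≤K : r * r ≤ K
  r*r≤K = begin
    r * r          ≡⟨ *-identityʳ (r * r) ⟨
    r * r * 1ℚ     ≤⟨ *-monoˡ-≤-nonNeg (r * r) {{nonNeg*nonNeg⇒nonNeg r r}} 1≤Δ*Δ ⟩
    r * r * (Δ * Δ) ∎
    where open ≤-Reasoning
          1≤Δ*Δ = ≤-trans 1≤Δ (≤-trans (≤-reflexive (sym (*-identityˡ Δ))) (*-monoʳ-≤-nonNeg Δ 1≤Δ))

  xᵢ-sq≤ : ∀ i → xᵢ r Δ i * xᵢ r Δ i ≤ ℕ→ℚ (4 ^ i) * K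
  xᵢ-sq≤ i = begin
    xᵢ r Δ i * xᵢ r Δ i                    ≡⟨ cong (λ x → x * x) (cong (Δ *_) (sumℚ-map-scaled (2 ^_) r (upTo i))) ⟩
    (Δ * (ℕ→ℚ s * r)) * (Δ * (ℕ→ℚ s * r))
      ≡⟨ solve 3 (λ d s r → (d :* (s :* r)) :* (d :* (s :* r)) := s :* s :* (r :* r :* (d :* d))) refl Δ (ℕ→ℚ s) r ⟩
    ℕ→ℚ s * ℕ→ℚ s * K                      ≡⟨ cong (_* K) (ℕ→ℚ-homo-* s s) ⟨
    ℕ→ℚ (s ℕ.* s) * K                      ≤⟨ *-monoʳ-≤-nonNeg K (ℕ→ℚ-mono-≤ (sum-2^-upTo-sq≤ i)) ⟩
    ℕ→ℚ (4 ^ i) * K                        ∎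
    where open ≤-Reasoning
          open ℚ-Solver.+-*-Solver
          s = sum (map (2 ^_) (upTo i))

  arm-sq≤ : ∀ j l → let y = ℕ→ℚ (2 ^ j) * rᵢ r (suc l) in y * y ≤ ℕ→ℚ (4 ^ j ℕ.* 4 ^ l) * K
  arm-sq≤ j l = begin
    (a * (b * r)) * (a * (b * r))
      ≡⟨ solve 3 (λ a b r → (a :* (b :* r)) :* (a :* (b :* r)) := a :* a :* (b :* b) :* (r :* r)) refl a b r ⟩
    a * a * (b * b) * (r * r)     ≡⟨ cong₂ (λ u v → u * v * (r * r)) (ℕ→ℚ-2^-sq j) (ℕ→ℚ-2^-sq l) ⟩
    ℕ→ℚ (4 ^ j) * ℕ→ℚ (4 ^ l) * (r * r) ≡⟨ cong (_* (r * r)) (ℕ→ℚ-homo-* (4 ^ j) (4 ^ l)) ⟨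
    ℕ→ℚ (4 ^ j ℕ.* 4 ^ l) * (r * r)
      ≤⟨ *-monoˡ-≤-nonNeg (ℕ→ℚ (4 ^ j ℕ.* 4 ^ l)) {{ℕ→ℚ-nonNeg (4 ^ j ℕ.* 4 ^ l)}} r*r≤K ⟩
    ℕ→ℚ (4 ^ j ℕ.* 4 ^ l) * K     ∎
    where open ≤-Reasoning
          open ℚ-Solver.+-*-Solver
          a = ℕ→ℚ (2 ^ j)
          b = ℕ→ℚ (2 ^ l)

  entry-cost≤ : ∀ i μ n b → b * b ≤ ℕ→ℚ n * K →
    cost₀ (entry i (xᵢ r Δ i , b) μ) ≤ ℕ→ℚ (μ ℕ.* (4 ^ i ℕ.+ n)) * K
  entry-cost≤ i μ n b b*b≤ = begin
    ℕ→ℚ μ * D (xᵢ r Δ i , b) origin            ≡⟨ cong (ℕ→ℚ μ *_) (D-origin (xᵢ r Δ i) b) ⟩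
    ℕ→ℚ μ * (xᵢ r Δ i * xᵢ r Δ i + b * b)
      ≤⟨ *-monoˡ-≤-nonNeg (ℕ→ℚ μ) {{ℕ→ℚ-nonNeg μ}} (+-mono-scaled K (4 ^ i) n (xᵢ-sq≤ i) b*b≤) ⟩
    ℕ→ℚ μ * (ℕ→ℚ (4 ^ i ℕ.+ n) * K)          ≡⟨ ℕ→ℚ-*-scaled K μ _ ⟩
    ℕ→ℚ (μ ℕ.* (4 ^ i ℕ.+ n)) * K            ∎
    where open ≤-Reasoning

  groupG-cost≤ : ∀ {i} → 1 ℕ.≤ i → sumℚ (map cost₀ (groupG k m r Δ i)) ≤ ℕ→ℚ (40 ℕ.* k ℕ.* m) * K
  groupG-cost≤ {suc l} _ = scaled-mono-≤ K (+-mono-scaled K (16 ℕ.* k ℕ.* m) _ centre≤ arms≤) (group-weight≤ k m)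
    where
    x = xᵢ r Δ (suc l)

    centre≤ : cost₀ (entry (suc l) (x , 0ℚ) (4 ℕ.* k ℕ.* mᵢ m (suc l))) ≤ ℕ→ℚ (16 ℕ.* k ℕ.* m) * K
    centre≤ = scaled-mono-≤ K (entry-cost≤ (suc l) (4 ℕ.* k ℕ.* mᵢ m (suc l)) 0 0ℚ 0*0≤0*K) (centre-weight≤ k m l)
      where 0*0≤0*K = ≤-reflexive (trans (*-zeroˡ 0ℚ) (sym (*-zeroˡ K)))

    armPair : ℕ → List Entry
    armPair j = entry (suc l) (x , y) μ ∷ entry (suc l) (x , - y) μ ∷ []
      where y = ℕ→ℚ (2 ^ j) * rᵢ r (suc l)
            μ = div4^ (mᵢ m (suc l)) j

    armPair-cost≤ : ∀ j → sumℚ (map cost₀ (armPair j)) ≤ ℕ→ℚ (5 ℕ.* m ℕ.+ (5 ℕ.* m ℕ.+ 0)) * K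
    armPair-cost≤ j = +-mono-scaled K (5 ℕ.* m) _ (arm≤ y (arm-sq≤ j l))
                        (+-mono-scaled K (5 ℕ.* m) 0 (arm≤ (- y) (≤-trans (≤-reflexive (-y*-y≡y*y y)) (arm-sq≤ j l)))
                                         (≤-reflexive (sym (*-zeroˡ K))))
      where
      y = ℕ→ℚ (2 ^ j) * rᵢ r (suc l)
      -y*-y≡y*y : ∀ y → - y * - y ≡ y * y
      -y*-y≡y*y y = solve 1 (λ y → (:- y) :* (:- y) := y :* y) refl y
        where open ℚ-Solver.+-*-Solver
      arm≤ : ∀ b → b * b ≤ ℕ→ℚ (4 ^ j ℕ.* 4 ^ l) * K →
             cost₀ (entry (suc l) (x , b) (div4^ (mᵢ m (suc l)) j)) ≤ ℕ→ℚ (5 ℕ.* m) * K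
      arm≤ b b*b≤ =
        scaled-mono-≤ K (entry-cost≤ (suc l) (div4^ (mᵢ m (suc l)) j) (4 ^ j ℕ.* 4 ^ l) b b*b≤) (arm-weight≤ m l j)

    arms≤ : sumℚ (map cost₀ (concatMap armPair (upTo k))) ≤ ℕ→ℚ (k ℕ.* (5 ℕ.* m ℕ.+ (5 ℕ.* m ℕ.+ 0))) * K
    arms≤ = ≤-trans (sumℚ-map-concatMap-≤ cost₀ (applyUpTo⁺₂ id k armPair-cost≤))
                    (≤-reflexive (trans (cong (λ n → ℕ→ℚ n * (ℕ→ℚ w * K)) (List.length-upTo k)) (ℕ→ℚ-*-scaled K k w)))
      where w = 5 ℕ.* m ℕ.+ (5 ℕ.* m ℕ.+ 0)

groupG-grp≡ : ∀ k m r Δ i → All (λ e → grp e ≡ i) (groupG k m r Δ i)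
groupG-grp≡ k m r Δ i = refl ∷ concat⁺ (map⁺ (applyUpTo⁺₂ id k (λ _ → refl ∷ refl ∷ [])))

Uncovered : ℕ → List Entry → List Pt → ℕ → Set
Uncovered k X C i = ((1 ℕ.≤ i) × (i ℕ.< k)) × (covered X C i ≡ false)

uncovered? : ∀ k X C → Decidable (Uncovered k X C)
uncovered? k X C i = ((1 ℕ.≤? i) ×-dec (i ℕ.<? k)) ×-dec (covered X C i Bool.≟ false)

-- uncoveredPart filters with uncovered? ∘ grp, and the entry of G₀ is dropped by computation.
uncoveredPart-instanceX : ∀ k m r Δ C →
  uncoveredPart k (instanceX k m r Δ) C ≡ concatMap (groupG k m r Δ) (filter (uncovered? k (instanceX k m r Δ) C) (groupIdx k))
uncoveredPart-instanceX k m r Δ C =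
  filter-concatMap (uncovered? k (instanceX k m r Δ) C) grp (groupG k m r Δ) (groupG-grp≡ k m r Δ) (groupIdx k)

uncovered-count≤ : ∀ k X C → length (filter (uncovered? k X C) (groupIdx k)) ℕ.≤ k ∸ numCovered k X C ∸ 1
uncovered-count≤ k X C = begin
  u                ≤⟨ ℕ.m+n≤o⇒m≤o∸n u u+s≤ ⟩
  k ∸ 1 ∸ s        ≡⟨ ℕ.∸-+-assoc k 1 s ⟩
  k ∸ (1 ℕ.+ s)    ≡⟨ cong (k ∸_) (ℕ.+-comm 1 s) ⟩
  k ∸ (s ℕ.+ 1)    ≡⟨ ℕ.∸-+-assoc k s 1 ⟨
  k ∸ s ∸ 1        ∎
  where
  open ℕ.≤-Reasoning
  u = length (filter (uncovered? k X C) (groupIdx k))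
  s = numCovered k X C
  u+s≤ : u ℕ.+ s ℕ.≤ k ∸ 1
  u+s≤ = ℕ.≤-trans
    (length-filter-disjoint (uncovered? k X C) (λ i → covered X C i Bool.≟ true)
       (λ (_ , uncov) cov → case trans (sym cov) uncov of λ ()) (groupIdx k))
    (ℕ.≤-reflexive (trans (List.length-map suc (upTo (k ∸ 1))) (List.length-upTo (k ∸ 1))))

lemma12 : (k m : ℕ) (r Δ : ℚ) (t : ℕ) (cs : List Pt) →
    2 ℕ.≤ k → 0 ℕ.< m → 4 ^ (2 ℕ.* k ∸ 3) ∣ m →
    0ℚ < r → 1ℚ ≤ Δ →
    t ℕ.≤ k ∸ 1 →
    length cs ≡ t →
    All (InX (instanceX k m r Δ)) cs →
    AllPairs _≢_ ((0ℚ , 0ℚ) ∷ cs) →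
    Φ (0ℚ , 0ℚ) cs
      (uncoveredPart k (instanceX k m r Δ) ((0ℚ , 0ℚ) ∷ cs))
      ≤ ℕ→ℚ (40 ℕ.* k ℕ.* (k ∸ numCovered k (instanceX k m r Δ) ((0ℚ , 0ℚ) ∷ cs) ∸ 1) ℕ.* m)
          * (r * r) * (Δ * Δ)
-- Only 0 < r and 1 ≤ Δ are needed: the bound holds for any centre list starting at (0,0),
-- and the truncated divisions in the multiplicities only make them smaller.
lemma12 k m r Δ t cs _ _ _ 0<r 1≤Δ _ _ _ _ = begin
  Φ origin cs Xᵤ                                  ≤⟨ Φ≤Φ-first origin cs Xᵤ ⟩
  Φ origin [] Xᵤ                                  ≡⟨ cong (Φ origin []) (uncoveredPart-instanceX k m r Δ C) ⟩
  sumℚ (map cost₀ (concatMap (groupG k m r Δ) U))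
    ≤⟨ sumℚ-map-concatMap-≤ cost₀ (All.map uncovered-cost≤ (all-filter _ (groupIdx k))) ⟩
  ℕ→ℚ (length U) * (ℕ→ℚ (40 ℕ.* k ℕ.* m) * K)    ≡⟨ ℕ→ℚ-*-scaled K (length U) (40 ℕ.* k ℕ.* m) ⟩
  ℕ→ℚ (length U ℕ.* (40 ℕ.* k ℕ.* m)) * K        ≤⟨ scaled-mono-≤ K ≤-refl weight≤ ⟩
  ℕ→ℚ N * K                                       ≡⟨ *-assoc (ℕ→ℚ N) (r * r) (Δ * Δ) ⟨
  ℕ→ℚ N * (r * r) * (Δ * Δ)                       ∎
  where
  instance
    r≥0 : NonNegative r
    r≥0 = nonNegative (<⇒≤ 0<r)
  open GroupCost k m r Δ 1≤Δ
  open ≤-Reasoning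
  X = instanceX k m r Δ
  C = origin ∷ cs
  Xᵤ = uncoveredPart k X C
  U = filter (uncovered? k X C) (groupIdx k)
  N = 40 ℕ.* k ℕ.* (k ∸ numCovered k X C ∸ 1) ℕ.* m

  uncovered-cost≤ : ∀ {i} → Uncovered k X C i → sumℚ (map cost₀ (groupG k m r Δ i)) ≤ ℕ→ℚ (40 ℕ.* k ℕ.* m) * K
  uncovered-cost≤ ((1≤i , _) , _) = groupG-cost≤ 1≤i

  weight≤ : length U ℕ.* (40 ℕ.* k ℕ.* m) ℕ.≤ N
  weight≤ = ℕ.≤-trans (ℕ.*-monoˡ-≤ (40 ℕ.* k ℕ.* m) (uncovered-count≤ k X C))
                      (ℕ.≤-reflexive (solve 3 (λ u k m → u :* (con 40 :* k :* m) := con 40 :* k :* u :* m) refl _ k m))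
    where open ℕ-Solver.+-*-Solver
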